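{- Let $H$ be a bicolored graph containing neither a handle nor a non-monochromatic triangle, and let $v\in V(H)$. Then $H\cup\mathrm{clone}(v)$ also contains neither a handle nor a non-monochromatic triangle.
   Context: A bicolored graph is a simple graph whose edges are each colored red or blue. A handle is a monochromatic triangle together with an edge of the other color having exactly one endpoint on the triangle. A non-monochromatic triangle is a triangle whose edges do not all have the same color. A bicolored graph contains $F$ if there is an injective vertex map sending every edge of $F$ to an edge of the same color. For $v\in V(H)$, $H\cup\mathrm{clone}(v)$ is the bicolored graph obtained from $H$ by adding a new vertex $v'$ with $N(v')=N(v)$, where each edge $\{v',x\}$ receives the color of $\{v,x\}$; in particular $v$ and $v'$ are not adjacent. -}

module Defs where

open import Data.Nat using (ℕ; suc)
open import Data.Fin using (Fin; zero; suc)
open import Data.Maybe using (Maybe; just; nothing)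
open import Data.Product using (Σ; _×_; ∃; ∃-syntax; _,_)
open import Relation.Binary.PropositionalEquality using (_≡_; refl)
open import Relation.Nullary using (¬_)
open import Function.Definitions using (Injective)

data Colour : Set where
  red blue : Colour

other : Colour → Colour
other red  = blue
other blue = red

-- A bicoloured (simple) graph on vertex set Fin n:
-- col x y = nothing  means x,y non-adjacent, just c means an edge of colour c.
record BGraph (n : ℕ) : Set where
  field
    col   : Fin n → Fin n → Maybe Colour
    irrefl : ∀ x → col x x ≡ nothing
    sym   : ∀ x y → col x y ≡ col y x
open BGraph public

Contains : ∀ {m n} → BGraph m → BGraph n → Set
Contains {m} {n} F H =
  Σ (Fin m → Fin n) λ f →
    Injective _≡_ _≡_ f ×
    (∀ x y c → col F x y ≡ just c → col H (f x) (f y) ≡ just c)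

triCol : Colour → Colour → Colour → Fin 3 → Fin 3 → Maybe Colour
triCol a b c zero zero = nothing
triCol a b c zero (suc zero) = just a
triCol a b c zero (suc (suc zero)) = just b
triCol a b c (suc zero) zero = just a
triCol a b c (suc zero) (suc zero) = nothing
triCol a b c (suc zero) (suc (suc zero)) = just c
triCol a b c (suc (suc zero)) zero = just b
triCol a b c (suc (suc zero)) (suc zero) = just c
triCol a b c (suc (suc zero)) (suc (suc zero)) = nothing

Triangle : Colour → Colour → Colour → BGraph 3
Triangle a b c = record { col = triCol a b c ; irrefl = ir ; sym = sy }
  where
  ir : ∀ x → triCol a b c x x ≡ nothing
  ir zero = refl
  ir (suc zero) = refl
  ir (suc (suc zero)) = refl
  sy : ∀ x y → triCol a b c x y ≡ triCol a b c y x
  sy zero zero = refl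
  sy zero (suc zero) = refl
  sy zero (suc (suc zero)) = refl
  sy (suc zero) zero = refl
  sy (suc zero) (suc zero) = refl
  sy (suc zero) (suc (suc zero)) = refl
  sy (suc (suc zero)) zero = refl
  sy (suc (suc zero)) (suc zero) = refl
  sy (suc (suc zero)) (suc (suc zero)) = refl

-- Handle: monochromatic triangle of colour c on {0,1,2}, plus an edge of
-- the other colour from vertex 0 to a new vertex 3.
handleCol : Colour → Fin 4 → Fin 4 → Maybe Colour
handleCol c zero (suc zero) = just c
handleCol c zero (suc (suc zero)) = just c
handleCol c zero (suc (suc (suc zero))) = just (other c)
handleCol c (suc zero) zero = just c
handleCol c (suc zero) (suc (suc zero)) = just c
handleCol c (suc (suc zero)) zero = just c
handleCol c (suc (suc zero)) (suc zero) = just c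
handleCol c (suc (suc (suc zero))) zero = just (other c)
handleCol c _ _ = nothing

Handle : Colour → BGraph 4
Handle c = record { col = handleCol c ; irrefl = ir ; sym = sy }
  where
  ir : ∀ x → handleCol c x x ≡ nothing
  ir zero = refl
  ir (suc zero) = refl
  ir (suc (suc zero)) = refl
  ir (suc (suc (suc zero))) = refl
  sy : ∀ x y → handleCol c x y ≡ handleCol c y x
  sy zero zero = refl
  sy zero (suc zero) = refl
  sy zero (suc (suc zero)) = refl
  sy zero (suc (suc (suc zero))) = refl
  sy (suc zero) zero = refl
  sy (suc zero) (suc zero) = refl
  sy (suc zero) (suc (suc zero)) = refl
  sy (suc zero) (suc (suc (suc zero))) = refl
  sy (suc (suc zero)) zero = refl
  sy (suc (suc zero)) (suc zero) = refl
  sy (suc (suc zero)) (suc (suc zero)) = refl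
  sy (suc (suc zero)) (suc (suc (suc zero))) = refl
  sy (suc (suc (suc zero))) zero = refl
  sy (suc (suc (suc zero))) (suc zero) = refl
  sy (suc (suc (suc zero))) (suc (suc zero)) = refl
  sy (suc (suc (suc zero))) (suc (suc (suc zero))) = refl

ContainsHandle : ∀ {n} → BGraph n → Set
ContainsHandle H = ∃[ c ] Contains (Handle c) H

ContainsNonMonoTriangle : ∀ {n} → BGraph n → Set
ContainsNonMonoTriangle H =
  ∃[ a ] ∃[ b ] ∃[ c ] (¬ (a ≡ b × b ≡ c) × Contains (Triangle a b c) H)

-- H ∪ clone(v): vertex set Fin (suc n); the new vertex v' is zero and the
-- old vertex x is suc x.  N(v') = N(v) with the same colours; v, v' non-adjacent.
cloneCol : ∀ {n} → BGraph n → Fin n → Fin (suc n) → Fin (suc n) → Maybe Colour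
cloneCol H v zero    zero    = nothing
cloneCol H v zero    (suc y) = col H v y
cloneCol H v (suc x) zero    = col H x v
cloneCol H v (suc x) (suc y) = col H x y

clone : ∀ {n} → BGraph n → Fin n → BGraph (suc n)
clone H v = record { col = cloneCol H v ; irrefl = ir ; sym = sy }
  where
  ir : ∀ x → cloneCol H v x x ≡ nothing
  ir zero = refl
  ir (suc x) = irrefl H x
  sy : ∀ x y → cloneCol H v x y ≡ cloneCol H v y x
  sy zero zero = refl
  sy zero (suc y) = sym H v y
  sy (suc x) zero = sym H x v
  sy (suc x) (suc y) = sym H x y

module Submission where

-- In H ∪ clone(v) the new vertex v′ (= zero) and the old vertex v
-- (= suc v) are false twins: they are non-adjacent, and every vertex sees
-- them through the same colour.  Hence an edge-preserving map from a pattern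
-- F into the clone can use both v′ and v only if F itself has two distinct,
-- non-adjacent vertices that no common neighbour distinguishes by colour.
-- Call F *separating* when every two of its vertices are equal, adjacent,
-- or joined to some third vertex by edges of different colours.  For a
-- separating F, folding v′ onto v turns every copy of F in the clone into a
-- copy of F in H (`pullback`).  Triangles (all pairs adjacent) and handles
-- (the two non-adjacent pairs are distinguished by the attachment vertex)
-- are separating, so neither can appear in the clone unless it already
-- appears in H.

open import Defs
open import Data.Nat using (ℕ; suc)
open import Data.Fin using (Fin; zero; suc)
open import Data.Maybe using (just; nothing)
open import Data.Maybe.Properties using (just-injective)
open import Data.Sum using (_⊎_; inj₁; inj₂)
open import Data.Product using (∃-syntax; _×_; _,_)
open import Data.Empty using (⊥; ⊥-elim)
open import Relation.Nullary using (¬_)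
open import Relation.Binary.PropositionalEquality
  using (_≡_; _≢_; refl; trans; cong; cong₂; module ≡-Reasoning)
  renaming (sym to ≡-sym)
open import Function.Definitions using (Injective)

colour≢other : ∀ c → c ≢ other c
colour≢other red  ()
colour≢other blue ()

Distinguished : ∀ {m} → BGraph m → Fin m → Fin m → Set
Distinguished F a b =
  ∃[ k ] ∃[ c ] ∃[ d ] (col F k a ≡ just c × col F k b ≡ just d × c ≢ d)

Separated : ∀ {m} → BGraph m → Fin m → Fin m → Set
Separated F a b = a ≡ b ⊎ (∃[ c ] col F a b ≡ just c) ⊎ Distinguished F a b

Separating : ∀ {m} → BGraph m → Set
Separating F = ∀ a b → Separated F a b

module _ {m : ℕ} (F : BGraph m) where

  equal : ∀ {a} → Separated F a a
  equal = inj₁ refl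

  adjacent : ∀ {a b c} → col F a b ≡ just c → Separated F a b
  adjacent e = inj₂ (inj₁ (_ , e))

  distinguishedBy : ∀ {a b c d} k → c ≢ d →
    col F k a ≡ just c → col F k b ≡ just d → Separated F a b
  distinguishedBy k c≢d ea eb = inj₂ (inj₂ (k , _ , _ , ea , eb , c≢d))

triangleSeparating : ∀ a b c → Separating (Triangle a b c)
triangleSeparating a b c = sep
  where
  T : BGraph 3
  T = Triangle a b c

  sep : Separating T
  sep zero             zero             = equal T
  sep zero             (suc zero)       = adjacent T refl
  sep zero             (suc (suc zero)) = adjacent T refl
  sep (suc zero)       zero             = adjacent T refl
  sep (suc zero)       (suc zero)       = equal T
  sep (suc zero)       (suc (suc zero)) = adjacent T refl
  sep (suc (suc zero)) zero             = adjacent T refl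
  sep (suc (suc zero)) (suc zero)       = adjacent T refl
  sep (suc (suc zero)) (suc (suc zero)) = equal T

-- In a handle the only non-adjacent pairs are a triangle vertex 1, 2 and the
-- pendant vertex 3; the attachment vertex 0 sees them in colours c, other c.
handleSeparating : ∀ c → Separating (Handle c)
handleSeparating c = sep
  where
  pendant : Fin 4
  pendant = suc (suc (suc zero))

  mono≢pendant : c ≢ other c
  mono≢pendant = colour≢other c

  pendant≢mono : other c ≢ c
  pendant≢mono e = colour≢other c (≡-sym e)

  sep : Separating (Handle c)
  sep zero                   zero                   = equal (Handle c)
  sep zero                   (suc zero)             = adjacent (Handle c) refl
  sep zero                   (suc (suc zero))       = adjacent (Handle c) refl
  sep zero                   (suc (suc (suc zero))) = adjacent (Handle c) refl
  sep (suc zero)             zero                   = adjacent (Handle c) refl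
  sep (suc zero)             (suc zero)             = equal (Handle c)
  sep (suc zero)             (suc (suc zero))       = adjacent (Handle c) refl
  sep (suc zero)             (suc (suc (suc zero))) = distinguishedBy (Handle c) zero mono≢pendant refl refl
  sep (suc (suc zero))       zero                   = adjacent (Handle c) refl
  sep (suc (suc zero))       (suc zero)             = adjacent (Handle c) refl
  sep (suc (suc zero))       (suc (suc zero))       = equal (Handle c)
  sep (suc (suc zero))       (suc (suc (suc zero))) = distinguishedBy (Handle c) zero mono≢pendant refl refl
  sep (suc (suc (suc zero))) zero                   = adjacent (Handle c) refl
  sep (suc (suc (suc zero))) (suc zero)             = distinguishedBy (Handle c) zero pendant≢mono refl refl
  sep (suc (suc (suc zero))) (suc (suc zero))       = distinguishedBy (Handle c) zero pendant≢mono refl refl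
  sep (suc (suc (suc zero))) (suc (suc (suc zero))) = equal (Handle c)

module _ {n : ℕ} (H : BGraph n) (v : Fin n) where

  twins-nonadjacent : cloneCol H v zero (suc v) ≡ nothing
  twins-nonadjacent = irrefl H v

  twins-sameColour : ∀ x → cloneCol H v x zero ≡ cloneCol H v x (suc v)
  twins-sameColour zero    = ≡-sym (irrefl H v)
  twins-sameColour (suc x) = refl

  Preserves : ∀ {m} → BGraph m → (Fin m → Fin (suc n)) → Set
  Preserves F f = ∀ x y c → col F x y ≡ just c → cloneCol H v (f x) (f y) ≡ just c

  avoidsTwins : ∀ {m} (F : BGraph m) (f : Fin m → Fin (suc n)) →
    Separating F → Preserves F f → ∀ a b → f a ≡ zero → f b ≡ suc v → ⊥
  avoidsTwins F f sep pres a b fa fb with sep a b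
  ... | inj₁ refl = twinsDiffer (trans (≡-sym fa) fb)
    where
    twinsDiffer : zero ≢ suc v
    twinsDiffer ()
  ... | inj₂ (inj₁ (c , eab)) = justNothing (begin
    just c                        ≡⟨ ≡-sym (pres a b c eab) ⟩
    cloneCol H v (f a) (f b)      ≡⟨ cong₂ (cloneCol H v) fa fb ⟩
    cloneCol H v zero (suc v)     ≡⟨ twins-nonadjacent ⟩
    nothing                       ∎)
    where
    open ≡-Reasoning
    justNothing : ∀ {c : Colour} → just c ≢ nothing
    justNothing ()
  ... | inj₂ (inj₂ (k , c , d , eka , ekb , c≢d)) = c≢d (just-injective (begin
    just c                        ≡⟨ ≡-sym (pres k a c eka) ⟩
    cloneCol H v (f k) (f a)      ≡⟨ cong (cloneCol H v (f k)) fa ⟩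
    cloneCol H v (f k) zero       ≡⟨ twins-sameColour (f k) ⟩
    cloneCol H v (f k) (suc v)    ≡⟨ cong (cloneCol H v (f k)) (≡-sym fb) ⟩
    cloneCol H v (f k) (f b)      ≡⟨ pres k b d ekb ⟩
    just d                        ∎))
    where open ≡-Reasoning

  fold : Fin (suc n) → Fin n
  fold zero    = v
  fold (suc x) = x

  fold-identifies : ∀ p q → fold p ≡ fold q →
    p ≡ q ⊎ (p ≡ zero × q ≡ suc v) ⊎ (q ≡ zero × p ≡ suc v)
  fold-identifies zero    zero    _    = inj₁ refl
  fold-identifies zero    (suc y) refl = inj₂ (inj₁ (refl , refl))
  fold-identifies (suc x) zero    refl = inj₂ (inj₂ (refl , refl))
  fold-identifies (suc x) (suc y) refl = inj₁ refl

  fold-preservesEdges : ∀ p q c → cloneCol H v p q ≡ just c → col H (fold p) (fold q) ≡ just c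
  fold-preservesEdges zero    zero    c ()
  fold-preservesEdges zero    (suc y) c e = e
  fold-preservesEdges (suc x) zero    c e = e
  fold-preservesEdges (suc x) (suc y) c e = e

  pullback : ∀ {m} (F : BGraph m) → Separating F → Contains F (clone H v) → Contains F H
  pullback F sep (f , f-inj , pres) = (λ x → fold (f x)) , folded-inj , folded-pres
    where
    folded-inj : Injective _≡_ _≡_ (λ x → fold (f x))
    folded-inj {x} {y} e with fold-identifies (f x) (f y) e
    ... | inj₁ fx≡fy            = f-inj fx≡fy
    ... | inj₂ (inj₁ (fx , fy)) = ⊥-elim (avoidsTwins F f sep pres x y fx fy)
    ... | inj₂ (inj₂ (fy , fx)) = ⊥-elim (avoidsTwins F f sep pres y x fy fx)
    folded-pres : ∀ x y c → col F x y ≡ just c → col H (fold (f x)) (fold (f y)) ≡ just c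
    folded-pres x y c e = fold-preservesEdges (f x) (f y) c (pres x y c e)

lemma4p5 : {n : ℕ} (H : BGraph n) (v : Fin n) →
    ¬ ContainsHandle H → ¬ ContainsNonMonoTriangle H →
    ¬ ContainsHandle (clone H v) × ¬ ContainsNonMonoTriangle (clone H v)
lemma4p5 H v noHandle noTriangle = noHandle′ , noTriangle′
  where
  noHandle′ : ¬ ContainsHandle (clone H v)
  noHandle′ (c , copy) = noHandle (c , pullback H v (Handle c) (handleSeparating c) copy)

  noTriangle′ : ¬ ContainsNonMonoTriangle (clone H v)
  noTriangle′ (a , b , c , nonMono , copy) =
    noTriangle (a , b , c , nonMono , pullback H v (Triangle a b c) (triangleSeparating a b c) copy)
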